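{- Fix positive integers $p$ and $n$. The map $(e_1,\dots,e_{n+p})\mapsto(e_{p+1},e_{p+2},\dots,e_{p+n})$ is a one-to-one correspondence between $\{e\in\mathbf{I}_{n+p}(0021):\mathsf{iar}(e)=p\}$ and $\mathbf{I}_{n,p}(021)$.
   Context: $\mathbf{I}_m=\{(e_1,\dots,e_m):0\le e_i<i\}$ is the set of inversion sequences of length $m$. For $e\in\mathbf{I}_m$, $\mathsf{iar}(e)$ is the unique index $p$ such that $e_i=i-1$ for $1\le i\le p$ and either $p=m$ or $e_{p+1}\le p-1$. For positive integers $n,p$, $\mathbf{I}_{n,p}$ is the set of integer sequences $(e_1,\dots,e_n)$ with $0\le e_1<p$ and $0\le e_i<p+i$ for $2\le i\le n$ (i.e. $\mathbf{s}$-inversion sequences for $\mathbf{s}=(p,p+2,p+3,\dots,p+n)$). A sequence avoids a pattern if no subsequence (not necessarily consecutive) is order isomorphic to it; $\mathbf{I}_m(0021)$ and $\mathbf{I}_{n,p}(021)$ denote the pattern-avoiding subsets. -}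

module Defs where

open import Data.Nat using (ℕ; zero; suc; _+_; _<_; _≤_; _≡ᵇ_)
open import Data.Bool using (if_then_else_)
open import Data.Fin as Fin using (Fin; toℕ)
open import Data.Vec using (Vec; []; _∷_; lookup; toList; drop)
open import Data.List using (List; []; _∷_)
open import Data.Product using (Σ; _×_)
open import Relation.Nullary using (¬_)
open import Relation.Binary.PropositionalEquality using (_≡_)

-- Sequences are vectors; position j : Fin m (0-based) is the paper's index j+1.

IsInvSeq : ∀ {m} → Vec ℕ m → Set
IsInvSeq {m} e = ∀ (j : Fin m) → lookup e j ≤ toℕ j

-- I_{n,p} : 0 ≤ e_1 < p and 0 ≤ e_i < p + i for 2 ≤ i ≤ n (1-based).
InInp : ∀ {n} → ℕ → Vec ℕ n → Set
InInp {n} p e = ∀ (j : Fin n) → Bound j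
  where
  Bound : Fin n → Set
  Bound j with toℕ j
  ... | zero  = lookup e j < p
  ... | suc k = lookup e j < p + suc (suc k)

-- iar(e): length of the longest prefix with e_i = i - 1 (1-based).
-- On inversion sequences this is exactly the unique p with e_i = i-1 for
-- i ≤ p and (p = m or e_{p+1} ≤ p - 1).
iarAux : ℕ → List ℕ → ℕ
iarAux k [] = 0
iarAux k (x ∷ xs) = if x ≡ᵇ k then suc (iarAux (suc k) xs) else 0

iar : ∀ {m} → Vec ℕ m → ℕ
iar e = iarAux 0 (toList e)

Contains : ∀ {m k} → Vec ℕ m → Vec ℕ k → Set
Contains {m} {k} e π =
  Σ (Fin k → Fin m) λ f →
    (∀ a b → a Fin.< b → f a Fin.< f b) ×
    (∀ a b → (lookup π a < lookup π b → lookup e (f a) < lookup e (f b)) ×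
             (lookup e (f a) < lookup e (f b) → lookup π a < lookup π b))

Avoids : ∀ {m k} → Vec ℕ m → Vec ℕ k → Set
Avoids e π = ¬ Contains e π

pat0021 : Vec ℕ 4
pat0021 = 0 ∷ 0 ∷ 2 ∷ 1 ∷ []

pat021 : Vec ℕ 3
pat021 = 0 ∷ 2 ∷ 1 ∷ []

SetA : (p n : ℕ) → Vec ℕ (p + n) → Set
SetA p n e = IsInvSeq e × Avoids e pat0021 × iar e ≡ p

SetB : (p n : ℕ) → Vec ℕ n → Set
SetB p n e = InInp p e × Avoids e pat021

{-# OPTIONS --safe #-}
module Submission where

open import Defs
open import Data.Nat using (ℕ; zero; suc; _+_; _≤_; _<_; _≡ᵇ_; z≤n; s≤s; s≤s⁻¹; z<s; s<s; _<?_)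
open import Data.Nat.Properties
open import Data.Bool using (true; false; T)
open import Data.Bool.Properties using (T-≡)
open import Data.Fin as Fin using (Fin; toℕ; _↑ʳ_; fromℕ<; reduce≥) renaming (zero to fz; suc to fs)
open import Data.Fin.Properties using (toℕ-↑ʳ; toℕ-fromℕ<; splitAt-≥; splitAt⁻¹-↑ʳ)
  renaming (<-cmp to <-cmpᶠ; <-trans to <-transᶠ)
open import Data.List using (List; _∷_)
open import Data.Vec using (Vec; []; _∷_; lookup; map; toList; drop; take; _++_)
open import Data.Vec.Properties using (lookup-++-<; lookup-++ʳ; lookup-map; take++drop≡id)
open import Data.Vec.Relation.Unary.Linked using (Linked; []; [-]; _∷_)
open import Data.Vec.Relation.Unary.Linked.Properties using (lookup⁺)
open import Data.Product using (Σ; ∃-syntax; _×_; _,_; proj₁; proj₂)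
open import Function using (_∘_)
open import Function.Bundles using (_⇔_; mk⇔; Equivalence)
open import Relation.Nullary using (yes; no; contradiction)
open import Relation.Binary using (tri<; tri≈; tri>)
open import Relation.Binary.PropositionalEquality

open Equivalence using (to; from)

-- Write e = s ++ f with s of length p. The condition iar e = p says exactly that
-- s is the staircase 0,1,…,p-1 and f₁ ≠ p; so e is determined by f, and the
-- inversion bound f₁ ≤ p sharpens to the bound f₁ < p of I_{n,p}. In a 0021 of e
-- the two equal entries cannot both lie in the strictly increasing staircase, so
-- the 021 part lies in f. Conversely, a 021 of f with smallest value a extends to
-- a 0021 of e by prepending the staircase entry a when a < p; otherwise f₁ < p ≤ a,
-- and the staircase entry f₁ followed by f₁ itself replaces a.

countFrom : ℕ → (p : ℕ) → Vec ℕ p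
countFrom k zero    = []
countFrom k (suc p) = k ∷ countFrom (suc k) p

staircase : (p : ℕ) → Vec ℕ p
staircase = countFrom 0

lookup-countFrom : ∀ k p (i : Fin p) → lookup (countFrom k p) i ≡ k + toℕ i
lookup-countFrom k (suc p) fz     = sym (+-identityʳ k)
lookup-countFrom k (suc p) (fs i) = trans (lookup-countFrom (suc k) p i) (sym (+-suc k (toℕ i)))

drop-++ : ∀ {A : Set} {m n} (xs : Vec A m) (ys : Vec A n) → drop m (xs ++ ys) ≡ ys
drop-++ []       ys = refl
drop-++ (x ∷ xs) ys = drop-++ xs ys

lookup-staircase-++-< : ∀ p {n} (f : Vec ℕ n) (i : Fin (p + n)) (i<p : toℕ i < p) →
  lookup (staircase p ++ f) i ≡ toℕ i
lookup-staircase-++-< p f i i<p = begin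
  lookup (staircase p ++ f) i         ≡⟨ lookup-++-< (staircase p) f i i<p ⟩
  lookup (staircase p) (fromℕ< i<p)   ≡⟨ lookup-countFrom 0 p (fromℕ< i<p) ⟩
  toℕ (fromℕ< i<p)                    ≡⟨ toℕ-fromℕ< i<p ⟩
  toℕ i                               ∎
  where open ≡-Reasoning

split-≥ : ∀ p {n} (i : Fin (p + n)) → p ≤ toℕ i → ∃[ j ] i ≡ p ↑ʳ j
split-≥ p i p≤i = reduce≥ i p≤i , sym (splitAt⁻¹-↑ʳ (splitAt-≥ p i p≤i))

↑ʳ-mono-< : ∀ p {n} {j j′ : Fin n} → j Fin.< j′ → p ↑ʳ j Fin.< p ↑ʳ j′
↑ʳ-mono-< p {j = j} {j′} j<j′ =
  subst₂ _<_ (sym (toℕ-↑ʳ p j)) (sym (toℕ-↑ʳ p j′)) (+-monoʳ-< p j<j′)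

↑ʳ-cancel-< : ∀ p {n} {j j′ : Fin n} → p ↑ʳ j Fin.< p ↑ʳ j′ → j Fin.< j′
↑ʳ-cancel-< p {j = j} {j′} lt =
  +-cancelˡ-< p (toℕ j) (toℕ j′) (subst₂ _<_ (toℕ-↑ʳ p j) (toℕ-↑ʳ p j′) lt)

≡ᵇ-refl : ∀ k → (k ≡ᵇ k) ≡ true
≡ᵇ-refl k = to T-≡ (≡⇒≡ᵇ k k refl)

iarAux-countFrom-++ : ∀ {n} k p (ys : Vec ℕ n) →
  iarAux k (toList (countFrom k p ++ ys)) ≡ p + iarAux (k + p) (toList ys)
iarAux-countFrom-++ k zero    ys rewrite +-identityʳ k = refl
iarAux-countFrom-++ k (suc p) ys rewrite ≡ᵇ-refl k | +-suc k p =
  cong suc (iarAux-countFrom-++ (suc k) p ys)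

iarAux-++⇒countFrom : ∀ {p n} k m (xs : Vec ℕ p) (ys : Vec ℕ n) →
  iarAux k (toList (xs ++ ys)) ≡ p + m → xs ≡ countFrom k p
iarAux-++⇒countFrom k m []       ys eq = refl
iarAux-++⇒countFrom k m (x ∷ xs) ys eq with x ≡ᵇ k in x≡ᵇk
... | true  = cong₂ _∷_ (≡ᵇ⇒≡ x k (from T-≡ x≡ᵇk))
                        (iarAux-++⇒countFrom (suc k) m xs ys (suc-injective eq))
... | false = contradiction eq 0≢1+n

iarAux-∷≡0⇔≢ : ∀ k y (ys : List ℕ) → iarAux k (y ∷ ys) ≡ 0 ⇔ (y ≢ k)
iarAux-∷≡0⇔≢ k y ys with y ≡ᵇ k in y≡ᵇk
... | true  = mk⇔ (λ ()) (λ y≢k → contradiction (≡ᵇ⇒≡ y k (from T-≡ y≡ᵇk)) y≢k)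
... | false = mk⇔ (λ _ y≡k → subst T y≡ᵇk (≡⇒≡ᵇ y k y≡k)) (λ _ → refl)

iar≡⇒staircase-++ : ∀ p {n} (e : Vec ℕ (p + n)) → iar e ≡ p → e ≡ staircase p ++ drop p e
iar≡⇒staircase-++ p e iar≡p = begin
  e                        ≡⟨ take++drop≡id p e ⟨
  take p e ++ drop p e     ≡⟨ cong (_++ drop p e) prefix ⟩
  staircase p ++ drop p e  ∎
  where
  open ≡-Reasoning
  prefix : take p e ≡ staircase p
  prefix = iarAux-++⇒countFrom 0 0 (take p e) (drop p e)
    (trans (cong iar (take++drop≡id p e)) (trans iar≡p (sym (+-identityʳ p))))

iar-staircase-++≡⇔≢ : ∀ p {n} y (ys : Vec ℕ n) → iar (staircase p ++ y ∷ ys) ≡ p ⇔ (y ≢ p)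
iar-staircase-++≡⇔≢ p y ys = mk⇔
  (λ iar≡p → to (iarAux-∷≡0⇔≢ p y (toList ys))
    (+-cancelˡ-≡ p _ 0 (trans (sym unfold) (trans iar≡p (sym (+-identityʳ p))))))
  (λ y≢p → trans unfold (trans (cong (p +_) (from (iarAux-∷≡0⇔≢ p y (toList ys)) y≢p))
                               (+-identityʳ p)))
  where
  unfold : iar (staircase p ++ y ∷ ys) ≡ p + iarAux p (y ∷ toList ys)
  unfold = iarAux-countFrom-++ 0 p (y ∷ ys)

isInvSeq-staircase-++⇔ : ∀ p {n} (f : Vec ℕ n) →
  IsInvSeq (staircase p ++ f) ⇔ (∀ j → lookup f j ≤ p + toℕ j)
isInvSeq-staircase-++⇔ p f = mk⇔ bounded invSeq
  where
  bounded : IsInvSeq (staircase p ++ f) → ∀ j → lookup f j ≤ p + toℕ j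
  bounded inv j = subst₂ _≤_ (lookup-++ʳ (staircase p) f j) (toℕ-↑ʳ p j) (inv (p ↑ʳ j))
  invSeq : (∀ j → lookup f j ≤ p + toℕ j) → IsInvSeq (staircase p ++ f)
  invSeq bnd i with toℕ i <? p
  ... | yes i<p = ≤-reflexive (lookup-staircase-++-< p f i i<p)
  ... | no i≮p with split-≥ p i (≮⇒≥ i≮p)
  ...   | j , refl = subst₂ _≤_ (sym (lookup-++ʳ (staircase p) f j)) (sym (toℕ-↑ʳ p j)) (bnd j)

inInp⇔ : ∀ p {n} y (ys : Vec ℕ n) →
  InInp p (y ∷ ys) ⇔ (y < p × ∀ j → lookup (y ∷ ys) j ≤ p + toℕ j)
inInp⇔ p y ys = mk⇔ (λ b → b fz , bounded b) inInp
  where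
  bounded : InInp p (y ∷ ys) → ∀ j → lookup (y ∷ ys) j ≤ p + toℕ j
  bounded b fz     = ≤-trans (<⇒≤ (b fz)) (m≤m+n p 0)
  bounded b (fs j) = s≤s⁻¹ (subst (suc (lookup ys j) ≤_) (+-suc p (suc (toℕ j))) (b (fs j)))
  inInp : y < p × (∀ j → lookup (y ∷ ys) j ≤ p + toℕ j) → InInp p (y ∷ ys)
  inInp (y<p , bnd) fz     = y<p
  inInp (y<p , bnd) (fs j) = subst (suc (lookup ys j) ≤_) (sym (+-suc p (suc (toℕ j)))) (s≤s (bnd (fs j)))

lookup-cancel-< : ∀ {r} {vs : Vec ℕ r} → Linked _<_ vs →
  ∀ {a b} → lookup vs a < lookup vs b → a Fin.< b
lookup-cancel-< vs↑ {a} {b} va<vb with <-cmpᶠ a b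
... | tri< a<b _ _ = a<b
... | tri≈ _ refl _ = contradiction va<vb (<-irrefl refl)
... | tri> _ _ b<a = contradiction va<vb (<-asym (lookup⁺ <-trans vs↑ b<a))

-- An occurrence is given by its positions and by the rank of each entry among
-- the increasing list vs of the values it takes.
contains-by-ranks : ∀ {m k r} (e : Vec ℕ m) (is : Vec (Fin m) k) (ranks : Vec (Fin r) k)
  (vs : Vec ℕ r) → Linked Fin._<_ is → Linked _<_ vs →
  map (lookup e) is ≡ map (lookup vs) ranks → Contains e (map toℕ ranks)
contains-by-ranks e is ranks vs is↑ vs↑ values = lookup is , (λ _ _ → lookup⁺ <-transᶠ is↑) , iso
  where
  value : ∀ a → lookup e (lookup is a) ≡ lookup vs (lookup ranks a)
  value a = begin
    lookup e (lookup is a)          ≡⟨ lookup-map a (lookup e) is ⟨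
    lookup (map (lookup e) is) a    ≡⟨ cong (λ v → lookup v a) values ⟩
    lookup (map (lookup vs) ranks) a ≡⟨ lookup-map a (lookup vs) ranks ⟩
    lookup vs (lookup ranks a)      ∎
    where open ≡-Reasoning
  iso : ∀ a b →
    (lookup (map toℕ ranks) a < lookup (map toℕ ranks) b →
       lookup e (lookup is a) < lookup e (lookup is b)) ×
    (lookup e (lookup is a) < lookup e (lookup is b) →
       lookup (map toℕ ranks) a < lookup (map toℕ ranks) b)
  iso a b rewrite lookup-map a toℕ ranks | lookup-map b toℕ ranks | value a | value b =
    lookup⁺ <-trans vs↑ , lookup-cancel-< vs↑

record Occurrence021 {n} (f : Vec ℕ n) : Set where
  constructor occurrence021
  field
    j₁ j₂ j₃ : Fin n
    j₁<j₂    : j₁ Fin.< j₂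
    j₂<j₃    : j₂ Fin.< j₃
    f₁<f₃    : lookup f j₁ < lookup f j₃
    f₃<f₂    : lookup f j₃ < lookup f j₂

record Occurrence0021 {m} (e : Vec ℕ m) : Set where
  constructor occurrence0021
  field
    i₀ i₁ i₂ i₃ : Fin m
    i₀<i₁       : i₀ Fin.< i₁
    i₁<i₂       : i₁ Fin.< i₂
    i₂<i₃       : i₂ Fin.< i₃
    e₀≡e₁       : lookup e i₀ ≡ lookup e i₁
    e₁<e₃       : lookup e i₁ < lookup e i₃
    e₃<e₂       : lookup e i₃ < lookup e i₂

contains-021⇔ : ∀ {n} (f : Vec ℕ n) → Contains f pat021 ⇔ Occurrence021 f
contains-021⇔ f = mk⇔ occurrence contains
  where
  occurrence : Contains f pat021 → Occurrence021 f
  occurrence (g , g↑ , iso) = occurrence021 (g fz) (g (fs fz)) (g (fs (fs fz)))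
    (g↑ _ _ z<s) (g↑ _ _ (s<s z<s))
    (proj₁ (iso fz (fs (fs fz))) z<s) (proj₁ (iso (fs (fs fz)) (fs fz)) (s<s z<s))
  contains : Occurrence021 f → Contains f pat021
  contains (occurrence021 j₁ j₂ j₃ j₁<j₂ j₂<j₃ f₁<f₃ f₃<f₂) =
    contains-by-ranks f (j₁ ∷ j₂ ∷ j₃ ∷ []) (fz ∷ fs (fs fz) ∷ fs fz ∷ [])
      (lookup f j₁ ∷ lookup f j₃ ∷ lookup f j₂ ∷ [])
      (j₁<j₂ ∷ j₂<j₃ ∷ [-]) (f₁<f₃ ∷ f₃<f₂ ∷ [-]) refl

contains-0021⇔ : ∀ {m} (e : Vec ℕ m) → Contains e pat0021 ⇔ Occurrence0021 e
contains-0021⇔ e = mk⇔ occurrence contains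
  where
  occurrence : Contains e pat0021 → Occurrence0021 e
  occurrence (g , g↑ , iso) = occurrence0021 (g fz) (g (fs fz)) (g (fs (fs fz))) (g (fs (fs (fs fz))))
    (g↑ _ _ z<s) (g↑ _ _ (s<s z<s)) (g↑ _ _ (s<s (s<s z<s)))
    (≤-antisym (≮⇒≥ (<-irrefl refl ∘ proj₂ (iso (fs fz) fz)))
               (≮⇒≥ (<-irrefl refl ∘ proj₂ (iso fz (fs fz)))))
    (proj₁ (iso (fs fz) (fs (fs (fs fz)))) z<s) (proj₁ (iso (fs (fs (fs fz))) (fs (fs fz))) (s<s z<s))
  contains : Occurrence0021 e → Contains e pat0021
  contains (occurrence0021 i₀ i₁ i₂ i₃ i₀<i₁ i₁<i₂ i₂<i₃ e₀≡e₁ e₁<e₃ e₃<e₂) =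
    contains-by-ranks e (i₀ ∷ i₁ ∷ i₂ ∷ i₃ ∷ []) (fz ∷ fz ∷ fs (fs fz) ∷ fs fz ∷ [])
      (lookup e i₁ ∷ lookup e i₃ ∷ lookup e i₂ ∷ [])
      (i₀<i₁ ∷ i₁<i₂ ∷ i₂<i₃ ∷ [-]) (e₁<e₃ ∷ e₃<e₂ ∷ [-]) (cong (_∷ _) e₀≡e₁)

staircase-++-occurrence0021 : ∀ p {n} (f : Vec ℕ n) {j₀ j₂ j₃ : Fin n} →
  j₀ Fin.< j₂ → j₂ Fin.< j₃ → lookup f j₀ < p →
  lookup f j₀ < lookup f j₃ → lookup f j₃ < lookup f j₂ → Occurrence0021 (staircase p ++ f)
staircase-++-occurrence0021 p {n} f {j₀} {j₂} {j₃} j₀<j₂ j₂<j₃ f₀<p f₀<f₃ f₃<f₂ =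
  occurrence0021 i₀ (p ↑ʳ j₀) (p ↑ʳ j₂) (p ↑ʳ j₃)
    i₀<p↑ʳj₀ (↑ʳ-mono-< p j₀<j₂) (↑ʳ-mono-< p j₂<j₃)
    (trans (trans (lookup-staircase-++-< p f i₀ i₀<p) toℕ-i₀) (sym (atʳ j₀)))
    (subst₂ _<_ (sym (atʳ j₀)) (sym (atʳ j₃)) f₀<f₃)
    (subst₂ _<_ (sym (atʳ j₃)) (sym (atʳ j₂)) f₃<f₂)
  where
  atʳ : ∀ j → lookup (staircase p ++ f) (p ↑ʳ j) ≡ lookup f j
  atʳ = lookup-++ʳ (staircase p) f
  i₀ : Fin (p + n)
  i₀ = fromℕ< (<-≤-trans f₀<p (m≤m+n p n))
  toℕ-i₀ : toℕ i₀ ≡ lookup f j₀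
  toℕ-i₀ = toℕ-fromℕ< (<-≤-trans f₀<p (m≤m+n p n))
  i₀<p : toℕ i₀ < p
  i₀<p = subst (_< p) (sym toℕ-i₀) f₀<p
  i₀<p↑ʳj₀ : i₀ Fin.< p ↑ʳ j₀
  i₀<p↑ʳj₀ = subst (toℕ i₀ <_) (sym (toℕ-↑ʳ p j₀)) (<-≤-trans i₀<p (m≤m+n p (toℕ j₀)))

occurrence021⇒staircase-++-occurrence0021 : ∀ p {n} (f : Vec ℕ (suc n)) → lookup f fz < p →
  Occurrence021 f → Occurrence0021 (staircase p ++ f)
occurrence021⇒staircase-++-occurrence0021 p f f₀<p (occurrence021 j₁ j₂ j₃ j₁<j₂ j₂<j₃ f₁<f₃ f₃<f₂)
  with lookup f j₁ <? p
... | yes f₁<p = staircase-++-occurrence0021 p f j₁<j₂ j₂<j₃ f₁<p f₁<f₃ f₃<f₂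
... | no  f₁≮p = staircase-++-occurrence0021 p f {fz} (≤-<-trans z≤n j₁<j₂) j₂<j₃ f₀<p
                   (<-trans f₀<p (≤-<-trans (≮⇒≥ f₁≮p) f₁<f₃)) f₃<f₂

staircase-++-occurrence0021⇒occurrence021 : ∀ p {n} (f : Vec ℕ n) →
  Occurrence0021 (staircase p ++ f) → Occurrence021 f
staircase-++-occurrence0021⇒occurrence021 p f
  (occurrence0021 i₀ i₁ i₂ i₃ i₀<i₁ i₁<i₂ i₂<i₃ e₀≡e₁ e₁<e₃ e₃<e₂) with toℕ i₁ <? p
... | yes i₁<p = contradiction i₀≡i₁ (<⇒≢ i₀<i₁)
  where
  open ≡-Reasoning
  i₀≡i₁ : toℕ i₀ ≡ toℕ i₁
  i₀≡i₁ = begin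
    toℕ i₀                          ≡⟨ lookup-staircase-++-< p f i₀ (<-trans i₀<i₁ i₁<p) ⟨
    lookup (staircase p ++ f) i₀    ≡⟨ e₀≡e₁ ⟩
    lookup (staircase p ++ f) i₁    ≡⟨ lookup-staircase-++-< p f i₁ i₁<p ⟩
    toℕ i₁                          ∎
... | no i₁≮p
  with split-≥ p i₁ (≮⇒≥ i₁≮p)
     | split-≥ p i₂ (≤-trans (≮⇒≥ i₁≮p) (<⇒≤ i₁<i₂))
     | split-≥ p i₃ (≤-trans (≮⇒≥ i₁≮p) (<⇒≤ (<-trans i₁<i₂ i₂<i₃)))
... | j₁ , refl | j₂ , refl | j₃ , refl =
  occurrence021 j₁ j₂ j₃ (↑ʳ-cancel-< p i₁<i₂) (↑ʳ-cancel-< p i₂<i₃)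
    (subst₂ _<_ (atʳ j₁) (atʳ j₃) e₁<e₃) (subst₂ _<_ (atʳ j₃) (atʳ j₂) e₃<e₂)
  where
  atʳ : ∀ j → lookup (staircase p ++ f) (p ↑ʳ j) ≡ lookup f j
  atʳ = lookup-++ʳ (staircase p) f

staircase-++-avoids-0021⇔avoids-021 : ∀ p {n} (f : Vec ℕ (suc n)) → lookup f fz < p →
  Avoids (staircase p ++ f) pat0021 ⇔ Avoids f pat021
staircase-++-avoids-0021⇔avoids-021 p f f₀<p = mk⇔
  (λ avoids → avoids ∘ from (contains-0021⇔ _)
                     ∘ occurrence021⇒staircase-++-occurrence0021 p f f₀<p ∘ to (contains-021⇔ f))
  (λ avoids → avoids ∘ from (contains-021⇔ f)
                     ∘ staircase-++-occurrence0021⇒occurrence021 p f ∘ to (contains-0021⇔ _))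

staircase-++-SetA⇔SetB : ∀ p {n} (f : Vec ℕ (suc n)) → SetA p (suc n) (staircase p ++ f) ⇔ SetB p (suc n) f
staircase-++-SetA⇔SetB p f@(y ∷ ys) = mk⇔ setB setA
  where
  setB : SetA p _ (staircase p ++ f) → SetB p _ f
  setB (inv , avoids , iar≡p) =
    from (inInp⇔ p y ys) (y<p , bounded) , to (staircase-++-avoids-0021⇔avoids-021 p f y<p) avoids
    where
    bounded : ∀ j → lookup f j ≤ p + toℕ j
    bounded = to (isInvSeq-staircase-++⇔ p f) inv
    y<p : y < p
    y<p = ≤∧≢⇒< (subst (y ≤_) (+-identityʳ p) (bounded fz)) (to (iar-staircase-++≡⇔≢ p y ys) iar≡p)
  setA : SetB p _ f → SetA p _ (staircase p ++ f)
  setA (inInp , avoids) =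
    from (isInvSeq-staircase-++⇔ p f) bounded ,
    from (staircase-++-avoids-0021⇔avoids-021 p f y<p) avoids ,
    from (iar-staircase-++≡⇔≢ p y ys) (<⇒≢ y<p)
    where
    y<p : y < p
    y<p = proj₁ (to (inInp⇔ p y ys) inInp)
    bounded : ∀ j → lookup f j ≤ p + toℕ j
    bounded = proj₂ (to (inInp⇔ p y ys) inInp)

mainTheorem6 : (p n : ℕ) → 1 ≤ p → 1 ≤ n →
    ((e : Vec ℕ (p + n)) → SetA p n e → SetB p n (drop p e)) ×
    ((e e′ : Vec ℕ (p + n)) → SetA p n e → SetA p n e′ → drop p e ≡ drop p e′ → e ≡ e′) ×
    ((f : Vec ℕ n) → SetB p n f → Σ (Vec ℕ (p + n)) (λ e → SetA p n e × drop p e ≡ f))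
mainTheorem6 p zero    _ ()
mainTheorem6 p (suc n) _ _ = image , injective , surjective
  where
  shape : ∀ {e} → SetA p (suc n) e → e ≡ staircase p ++ drop p e
  shape {e} (_ , _ , iar≡p) = iar≡⇒staircase-++ p e iar≡p
  image : (e : Vec ℕ (p + suc n)) → SetA p (suc n) e → SetB p (suc n) (drop p e)
  image e a = to (staircase-++-SetA⇔SetB p (drop p e)) (subst (SetA p (suc n)) (shape a) a)
  injective : (e e′ : Vec ℕ (p + suc n)) → SetA p (suc n) e → SetA p (suc n) e′ →
              drop p e ≡ drop p e′ → e ≡ e′
  injective e e′ a a′ same = trans (shape a) (trans (cong (staircase p ++_) same) (sym (shape a′)))
  surjective : (f : Vec ℕ (suc n)) → SetB p (suc n) f →
               Σ (Vec ℕ (p + suc n)) (λ e → SetA p (suc n) e × drop p e ≡ f)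
  surjective f b = staircase p ++ f , from (staircase-++-SetA⇔SetB p f) b , drop-++ (staircase p) f
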